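{- $d(1)=1$, $d(2)=2$, and $d(3)=5$. Moreover, if $A$ is a set of three positive integers, then $d(A)=5$ if and only if $A=\{a,2a,3a\}$ for some positive integer $a$.
   Context: For a finite set $A$ of positive integers, write $\sum A$ for the sum of its elements (with $\sum\emptyset=0$). A subset $B\subseteq A$ is a divisor of $A$ if $\sum B$ divides $\sum A$ (the empty set is not a divisor of nonempty $A$). $d(A)$ is the number of divisors of $A$, and $d(n)$ is the maximum of $d(A)$ over all sets $A$ of $n$ positive integers. -}

module Defs where

open import Data.Nat using (ℕ; _<_; _≤_; _<?_)
open import Data.Nat.Divisibility using (_∣_; _∣?_)
open import Data.List using (List; []; _∷_; [_]; _++_; map; length; filter)
open import Data.Nat.ListAction using (sum)
open import Data.List.Relation.Unary.All using (All)
open import Data.List.Relation.Unary.Unique.Propositional using (Unique)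
open import Data.Product using (_×_; Σ; ∃)
open import Relation.Nullary.Decidable using (_×-dec_)
open import Relation.Binary.PropositionalEquality using (_≡_)

-- A finite set of n positive integers, represented by a duplicate-free list
-- of positive naturals of length n (order is irrelevant for everything below).
IsPosSet : ℕ → List ℕ → Set
IsPosSet n A = Unique A × All (0 <_) A × length A ≡ n

subsets : List ℕ → List (List ℕ)
subsets []       = [ [] ]
subsets (x ∷ xs) = subsets xs ++ map (x ∷_) (subsets xs)

-- B is a divisor of A: B nonempty (equivalently, as elements are positive,
-- ΣB > 0) and ΣB ∣ ΣA.
d : List ℕ → ℕ
d A = length (filter (λ B → (0 <? sum B) ×-dec (sum B ∣? sum A)) (subsets A))

-- "d(n) = m": m is the maximum of d(A) over sets A of n positive integers.
DMax : ℕ → ℕ → Set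
DMax n m = (Σ (List ℕ) λ A → IsPosSet n A × d A ≡ m)
         × (∀ A → IsPosSet n A → d A ≤ m)

-- A nonempty proper subset B of a set A of positive integers can only divide A if
-- ΣB ≤ Σ(A ∖ B), since ΣB divides Σ(A ∖ B). Hence for A = {x, y} the two singletons cannot
-- both divide (x ∣ y and y ∣ x), so d(A) ≤ 2. For A = {x, y, z} a dividing pair {p, q} forces
-- p + q ≤ r for the third element r, and two such inequalities contradict each other, so at
-- most one pair divides and d(A) ≤ 3 + 1 + 1 = 5. Equality means that every singleton and some
-- pair {p, q} divide; then r ∣ p + q ∣ r gives r = p + q, so p ∣ 2q and q ∣ 2p, and if p < q
-- the multiple 2p of q lies below 2q, forcing q = 2p and A = {p, 2p, 3p}. Conversely
-- {a, 2a, 3a} sums to 6a, which each element and the pair {a, 2a} divide.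
module Submission where

open import Data.Bool using (if_then_else_)
open import Data.Empty using (⊥)
open import Data.List using (List; []; _∷_; [_]; length; filter; map)
open import Data.List.Properties using (length-filter)
open import Data.List.Membership.Propositional using (_∈_)
open import Data.List.Membership.Propositional.Properties.WithK using (unique∧set⇒bag)
open import Data.List.Relation.Binary.BagAndSetEquality using (∼bag⇒↭)
open import Data.List.Relation.Binary.Permutation.Propositional
  using (_↭_; ↭-refl; ↭-sym; ↭-trans; ↭-prep; ↭-swap; ↭-reflexive)
open import Data.List.Relation.Binary.Permutation.Propositional.Properties using (∈-resp-↭)
open import Data.List.Relation.Unary.All using ([]; _∷_)
open import Data.List.Relation.Unary.AllPairs using ([]; _∷_)
open import Data.List.Relation.Unary.Any using (here; there)
open import Data.List.Relation.Unary.Unique.Propositional using (Unique)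
open import Data.Nat using (ℕ; zero; suc; _+_; _*_; _≤_; _<_; _<?_; z≤n; z<s; >-nonZero)
open import Data.Nat.Divisibility
  using (_∣_; _∣?_; divides; ∣-refl; ∣-antisym; ∣⇒≤; ∣m+n∣m⇒∣n; ∣m∣n⇒∣m+n; n∣m*n)
open import Data.Nat.ListAction using (sum)
open import Data.Nat.ListAction.Properties using (sum-↭)
open import Data.Nat.Properties
open import Data.Nat.Tactic.RingSolver using (solve-∀)
open import Data.Product using (_×_; _,_; ∃; map₂)
open import Data.Product.Function.NonDependent.Propositional using (_×-⇔_)
open import Data.Sum using (_⊎_; inj₁; inj₂)
open import Data.Sum.Function.Propositional using (_⊎-⇔_)
open import Function.Base using (_∘_)
open import Function.Bundles using (_⇔_; mk⇔; Equivalence)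
open import Function.Properties.Equivalence using () renaming (trans to ⇔-trans)
open import Level using (Level)
open import Relation.Binary.Definitions using (tri<; tri≈; tri>)
open import Relation.Binary.PropositionalEquality
  using (_≡_; _≢_; refl; sym; trans; cong; cong₂; subst; module ≡-Reasoning)
open import Relation.Nullary using (Dec; yes; no; does; ¬_; contradiction)
open import Relation.Nullary.Decidable using (_×-dec_; _⊎-dec_)
open import Relation.Unary using (Pred; Decidable)

open import Defs

open Equivalence using (to; from)

private
  variable
    ℓ ℓ′ : Level
    P Q R : Set ℓ
    a b m n p q r w x y N : ℕ

𝟙 : Dec P → ℕ
𝟙 P? = if does P? then 1 else 0

𝟙≤1 : (P? : Dec P) → 𝟙 P? ≤ 1
𝟙≤1 (yes _) = ≤-refl
𝟙≤1 (no _)  = z≤n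

𝟙≡1⇔ : (P? : Dec P) → 𝟙 P? ≡ 1 ⇔ P
𝟙≡1⇔ (yes p) = mk⇔ (λ _ → p) (λ _ → refl)
𝟙≡1⇔ (no ¬p) = mk⇔ (λ ()) (λ p → contradiction p ¬p)

𝟙-+-exclusive : (P → ¬ Q) → (P? : Dec P) (Q? : Dec Q) → 𝟙 P? + 𝟙 Q? ≡ 𝟙 (P? ⊎-dec Q?)
𝟙-+-exclusive excl (yes p) (yes q) = contradiction q (excl p)
𝟙-+-exclusive _    (yes _) (no _)  = refl
𝟙-+-exclusive _    (no _)  (yes _) = refl
𝟙-+-exclusive _    (no _)  (no _)  = refl

+-≤-tight : m ≤ a → n ≤ b → m + n ≡ a + b → m ≡ a × n ≡ b
+-≤-tight {m} {a} {n} {b} m≤a n≤b eq = m≡a , +-cancelˡ-≡ a n b (trans (cong (_+ n) (sym m≡a)) eq)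
  where
  m≡a : m ≡ a
  m≡a = ≤-antisym m≤a (≮⇒≥ λ m<a → <-irrefl eq (+-mono-<-≤ m<a n≤b))

𝟙+𝟙+𝟙≡3⇔ : (P? : Dec P) (Q? : Dec Q) (R? : Dec R) → 𝟙 P? + 𝟙 Q? + 𝟙 R? ≡ 3 ⇔ (P × Q × R)
𝟙+𝟙+𝟙≡3⇔ {P = P} {Q = Q} {R = R} P? Q? R? = mk⇔ all-hold
  (λ (p , q , r) → cong₂ _+_ (cong₂ _+_ (from (𝟙≡1⇔ P?) p) (from (𝟙≡1⇔ Q?) q)) (from (𝟙≡1⇔ R?) r))
  where
  all-hold : 𝟙 P? + 𝟙 Q? + 𝟙 R? ≡ 3 → P × Q × R
  all-hold eq with +-≤-tight (+-mono-≤ (𝟙≤1 P?) (𝟙≤1 Q?)) (𝟙≤1 R?) eq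
  ... | pq≡2 , r≡1 with +-≤-tight (𝟙≤1 P?) (𝟙≤1 Q?) pq≡2
  ... | p≡1 , q≡1 = to (𝟙≡1⇔ P?) p≡1 , to (𝟙≡1⇔ Q?) q≡1 , to (𝟙≡1⇔ R?) r≡1

length-filter≡sum-𝟙 : {B : Set ℓ} {P : Pred B ℓ′} (P? : Decidable P) (xs : List B) →
                      length (filter P? xs) ≡ sum (map (𝟙 ∘ P?) xs)
length-filter≡sum-𝟙 P? []       = refl
length-filter≡sum-𝟙 P? (x ∷ xs) with P? x
... | yes _ = cong suc (length-filter≡sum-𝟙 P? xs)
... | no _  = length-filter≡sum-𝟙 P? xs

↭⇒∈⇔ : {B : Set ℓ} {xs ys : List B} → xs ↭ ys → ∀ x → x ∈ xs ⇔ x ∈ ys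
↭⇒∈⇔ σ _ = mk⇔ (∈-resp-↭ σ) (∈-resp-↭ (↭-sym σ))

∈⇔⇒↭ : {B : Set ℓ} {xs ys : List B} → Unique xs → Unique ys → (∀ x → x ∈ xs ⇔ x ∈ ys) → xs ↭ ys
∈⇔⇒↭ xs! ys! ∈⇔ = ∼bag⇒↭ (unique∧set⇒bag xs! ys! (∈⇔ _))

IsDivisor : List ℕ → List ℕ → Set
IsDivisor A B = 0 < sum B × sum B ∣ sum A

isDivisor? : ∀ A → Decidable (IsDivisor A)
isDivisor? A B = (0 <? sum B) ×-dec (sum B ∣? sum A)

singleton-isDivisor⇔ : ∀ A → 0 < w → IsDivisor A [ w ] ⇔ w ∣ sum A
singleton-isDivisor⇔ {w} A w>0 = mk⇔
  (λ (_ , w∣) → subst (_∣ sum A) (+-identityʳ w) w∣)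
  (λ w∣ → subst (0 <_) (sym (+-identityʳ w)) w>0 , subst (_∣ sum A) (sym (+-identityʳ w)) w∣)

pair-isDivisor⇔ : ∀ A q → 0 < p → IsDivisor A (p ∷ q ∷ []) ⇔ p + q ∣ sum A
pair-isDivisor⇔ {p} A q p>0 = mk⇔
  (λ (_ , pq∣) → subst (_∣ sum A) (cong (p +_) (+-identityʳ q)) pq∣)
  (λ pq∣ → ≤-trans p>0 (m≤m+n p _) , subst (_∣ sum A) (cong (p +_) (sym (+-identityʳ q))) pq∣)

∣-complement-≤ : 0 < n → m ∣ m + n → m ≤ n
∣-complement-≤ n>0 m∣m+n = ∣⇒≤ {{>-nonZero n>0}} (∣m+n∣m⇒∣n m∣m+n ∣-refl)

pair-isDivisor⇒≤ : ∀ A q → 0 < p → 0 < r → sum A ≡ p + q + r → IsDivisor A (p ∷ q ∷ []) → p + q ≤ r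
pair-isDivisor⇒≤ {p} A q p>0 r>0 sum≡ D =
  ∣-complement-≤ r>0 (subst (p + q ∣_) sum≡ (to (pair-isDivisor⇔ A q p>0) D))

crossed-bounds⇒⊥ : 0 < p → p + q ≤ r → p + r ≤ q → ⊥
crossed-bounds⇒⊥ {p} {q} {r} p>0 pq≤r pr≤q = <⇒≱ p>0 (+-cancelʳ-≤ q p 0 (begin
  p + q ≤⟨ pq≤r ⟩
  r     ≤⟨ m≤n+m r p ⟩
  p + r ≤⟨ pr≤q ⟩
  q     ∎))
  where open ≤-Reasoning

∣-both-summands⇒≡ : m ∣ m + n → n ∣ m + n → m ≡ n
∣-both-summands⇒≡ {m} {n} m∣ n∣ =
  ∣-antisym (∣m+n∣m⇒∣n m∣ ∣-refl) (∣m+n∣m⇒∣n (subst (n ∣_) (+-comm m n) n∣) ∣-refl)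

∣∧<double⇒≡ : n ∣ m → 0 < m → m < n + n → m ≡ n
∣∧<double⇒≡ (divides zero refl) () _
∣∧<double⇒≡ {n} (divides (suc zero) refl) _ _ = +-identityʳ n
∣∧<double⇒≡ {n} (divides (suc (suc k)) refl) _ m<2n =
  contradiction m<2n (≤⇒≯ (+-monoʳ-≤ n (m≤m+n n (k * n))))

∣-double-sum⇒∣-double : m ∣ (m + n) + (m + n) → m ∣ n + n
∣-double-sum⇒∣-double {m} {n} m∣ =
  ∣m+n∣m⇒∣n (subst (m ∣_) (regroup m n) m∣) (∣m∣n⇒∣m+n ∣-refl ∣-refl)
  where
  regroup : ∀ m n → (m + n) + (m + n) ≡ (m + m) + (n + n)
  regroup = solve-∀

mutual-∣-double⇒double : 0 < p → 0 < q → p ≢ q → p ∣ q + q → q ∣ p + p → q ≡ p + p ⊎ p ≡ q + q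
mutual-∣-double⇒double {p} {q} p>0 q>0 p≢q p∣2q q∣2p with <-cmp p q
... | tri< p<q _ _ = inj₁ (sym (∣∧<double⇒≡ q∣2p (+-mono-< p>0 p>0) (+-mono-< p<q p<q)))
... | tri≈ _ p≡q _ = contradiction p≡q p≢q
... | tri> _ _ q<p = inj₂ (sym (∣∧<double⇒≡ p∣2q (+-mono-< q>0 q>0) (+-mono-< q<p q<p)))

complement-∣ : ∀ p q r → N ≡ p + q + r → N ≡ r + r → p + q ∣ N
complement-∣ {N} p q r N≡pqr N≡rr = subst (p + q ∣_) (sym N≡double) (∣m∣n⇒∣m+n ∣-refl ∣-refl)
  where
  pq≡r : p + q ≡ r
  pq≡r = +-cancelʳ-≡ r (p + q) r (trans (sym N≡pqr) N≡rr)
  N≡double : N ≡ (p + q) + (p + q)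
  N≡double = trans N≡rr (cong₂ _+_ (sym pq≡r) (sym pq≡r))

oneTwoThree : ℕ → List ℕ
oneTwoThree a = a ∷ 2 * a ∷ 3 * a ∷ []

sum-oneTwoThree : ∀ a → sum (oneTwoThree a) ≡ 3 * a + 3 * a
sum-oneTwoThree = regroup
  where
  regroup : ∀ a → a + (2 * a + (3 * a + 0)) ≡ 3 * a + 3 * a
  regroup = solve-∀

∈-oneTwoThree⇒∣ : w ∈ oneTwoThree a → w ∣ 3 * a + 3 * a
∈-oneTwoThree⇒∣ {a = a} (here refl) = subst (a ∣_) (six a) (n∣m*n 6)
  where
  six : ∀ a → 6 * a ≡ 3 * a + 3 * a
  six = solve-∀
∈-oneTwoThree⇒∣ {a = a} (there (here refl)) = subst (2 * a ∣_) (three a) (n∣m*n 3)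
  where
  three : ∀ a → 3 * (2 * a) ≡ 3 * a + 3 * a
  three = solve-∀
∈-oneTwoThree⇒∣ (there (there (here refl))) = ∣m∣n⇒∣m+n ∣-refl ∣-refl

unique-oneTwoThree : 0 < a → Unique (oneTwoThree a)
unique-oneTwoThree {a} a>0 =
  (<⇒≢ a<2a ∷ <⇒≢ (<-trans a<2a 2a<3a) ∷ []) ∷ (<⇒≢ 2a<3a ∷ []) ∷ [] ∷ []
  where
  a<2a : a < 2 * a
  a<2a = m<m+n a (subst (0 <_) (sym (*-identityˡ a)) a>0)
  2a<3a : 2 * a < 3 * a
  2a<3a = m<n+m (2 * a) a>0

oneTwoThree-≡ : q ≡ p + p → r ≡ p + q → p ∷ q ∷ r ∷ [] ≡ oneTwoThree p
oneTwoThree-≡ {p = p} refl refl = cong₂ (λ u v → p ∷ u ∷ v ∷ []) (two p) (three p)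
  where
  two : ∀ p → p + p ≡ 2 * p
  two = solve-∀
  three : ∀ p → p + (p + p) ≡ 3 * p
  three = solve-∀

-- r = p + q is forced by r ∣ N and p + q ∣ N; then p ∣ 2q and q ∣ 2p.
dividing-triple⇒↭oneTwoThree : 0 < p → 0 < q → p ≢ q → N ≡ p + q + r →
                               p ∣ N → q ∣ N → r ∣ N → p + q ∣ N →
                               ∃ λ a → 0 < a × (p ∷ q ∷ r ∷ []) ↭ oneTwoThree a
dividing-triple⇒↭oneTwoThree {p} {q} {N} {r} p>0 q>0 p≢q refl p∣ q∣ r∣ pq∣ =
  shape (mutual-∣-double⇒double p>0 q>0 p≢q (∣-double-sum⇒∣-double p∣2N) (∣-double-sum⇒∣-double q∣2N))
  where
  r≡pq : r ≡ p + q
  r≡pq = sym (∣-both-summands⇒≡ pq∣ r∣)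
  p∣2N : p ∣ (p + q) + (p + q)
  p∣2N = subst (λ t → p ∣ p + q + t) r≡pq p∣
  q∣2N : q ∣ (q + p) + (q + p)
  q∣2N = subst (λ t → q ∣ t + t) (+-comm p q) (subst (λ t → q ∣ p + q + t) r≡pq q∣)
  shape : q ≡ p + p ⊎ p ≡ q + q → ∃ λ a → 0 < a × (p ∷ q ∷ r ∷ []) ↭ oneTwoThree a
  shape (inj₁ q≡2p) = p , p>0 , ↭-reflexive (oneTwoThree-≡ q≡2p r≡pq)
  shape (inj₂ p≡2q) = q , q>0 , ↭-trans (↭-swap p q ↭-refl)
                                  (↭-reflexive (oneTwoThree-≡ p≡2q (trans r≡pq (+-comm p q))))

sum-three : ∀ x y z → sum (x ∷ y ∷ z ∷ []) ≡ x + y + z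
sum-three = regroup
  where
  regroup : ∀ x y z → x + (y + (z + 0)) ≡ x + y + z
  regroup = solve-∀

-- The empty subset is rejected by evaluation, leaving the single candidate [ x ].
d-singleton≤1 : ∀ x → d (x ∷ []) ≤ 1
d-singleton≤1 x = length-filter (isDivisor? (x ∷ [])) ((x ∷ []) ∷ [])

d-pair≤2 : 0 < x → 0 < y → x ≢ y → d (x ∷ y ∷ []) ≤ 2
d-pair≤2 {x} {y} x>0 y>0 x≢y = begin
  d xy                           ≡⟨ length-filter≡sum-𝟙 (isDivisor? xy) (subsets xy) ⟩
  𝟙 y? + (𝟙 x? + (𝟙 xy? + 0))   ≡⟨ +-assoc (𝟙 y?) (𝟙 x?) (𝟙 xy? + 0) ⟨
  (𝟙 y? + 𝟙 x?) + (𝟙 xy? + 0)   ≡⟨ cong (_+ (𝟙 xy? + 0)) (𝟙-+-exclusive y-x y? x?) ⟩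
  𝟙 (y? ⊎-dec x?) + (𝟙 xy? + 0) ≤⟨ +-mono-≤ (𝟙≤1 (y? ⊎-dec x?)) (+-monoˡ-≤ 0 (𝟙≤1 xy?)) ⟩
  2                              ∎
  where
  open ≤-Reasoning
  xy : List ℕ
  xy = x ∷ y ∷ []
  x? = isDivisor? xy [ x ]
  y? = isDivisor? xy [ y ]
  xy? = isDivisor? xy xy
  ∣x+y : 0 < w → IsDivisor xy [ w ] → w ∣ x + y
  ∣x+y {w} w>0 D = subst (w ∣_) (cong (x +_) (+-identityʳ y)) (to (singleton-isDivisor⇔ xy w>0) D)
  y-x : IsDivisor xy [ y ] → ¬ IsDivisor xy [ x ]
  y-x Dy Dx = x≢y (∣-both-summands⇒≡ (∣x+y x>0 Dx) (∣x+y y>0 Dy))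

module Triple {x y z : ℕ} (x>0 : 0 < x) (y>0 : 0 < y) (z>0 : 0 < z) where

  xyz : List ℕ
  xyz = x ∷ y ∷ z ∷ []

  S : ℕ
  S = sum xyz

  divisor? : Decidable (IsDivisor xyz)
  divisor? = isDivisor? xyz

  𝟙[_] : List ℕ → ℕ
  𝟙[ B ] = 𝟙 (divisor? B)

  singletonCount pairCount : ℕ
  singletonCount = 𝟙[ [ x ] ] + 𝟙[ [ y ] ] + 𝟙[ [ z ] ]
  pairCount      = 𝟙[ x ∷ y ∷ [] ] + 𝟙[ x ∷ z ∷ [] ] + 𝟙[ y ∷ z ∷ [] ]

  d≡counts : d xyz ≡ singletonCount + pairCount + 1
  d≡counts = begin
    d xyz
      ≡⟨ length-filter≡sum-𝟙 divisor? (subsets xyz) ⟩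
    0 + (𝟙[ [ z ] ] + (𝟙[ [ y ] ] + (𝟙[ y ∷ z ∷ [] ] + (𝟙[ [ x ] ] + (𝟙[ x ∷ z ∷ [] ]
      + (𝟙[ x ∷ y ∷ [] ] + (𝟙[ xyz ] + 0)))))))
      ≡⟨ regroup 𝟙[ [ x ] ] 𝟙[ [ y ] ] 𝟙[ [ z ] ]
                 𝟙[ x ∷ y ∷ [] ] 𝟙[ x ∷ z ∷ [] ] 𝟙[ y ∷ z ∷ [] ] 𝟙[ xyz ] ⟩
    singletonCount + pairCount + 𝟙[ xyz ]
      ≡⟨ cong (singletonCount + pairCount +_) self-divides ⟩
    singletonCount + pairCount + 1
      ∎
    where
    open ≡-Reasoning
    self-divides : 𝟙[ xyz ] ≡ 1
    self-divides = from (𝟙≡1⇔ (divisor? xyz)) (≤-trans x>0 (m≤m+n x _) , ∣-refl)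
    regroup : ∀ a b c e f g h →
              0 + (c + (b + (g + (a + (f + (e + (h + 0))))))) ≡ a + b + c + (e + f + g) + h
    regroup = solve-∀

  xyz↭xzy : xyz ↭ x ∷ z ∷ y ∷ []
  xyz↭xzy = ↭-prep x (↭-swap y z ↭-refl)

  xyz↭yzx : xyz ↭ y ∷ z ∷ x ∷ []
  xyz↭yzx = ↭-trans (↭-swap x y ↭-refl) (↭-prep y (↭-swap x z ↭-refl))

  S≡xy+z : S ≡ x + y + z
  S≡xy+z = sum-three x y z

  S≡xz+y : S ≡ x + z + y
  S≡xz+y = trans (sum-↭ xyz↭xzy) (sum-three x z y)

  S≡yz+x : S ≡ y + z + x
  S≡yz+x = trans (sum-↭ xyz↭yzx) (sum-three y z x)

  xy? : Dec (IsDivisor xyz (x ∷ y ∷ []))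
  xy? = divisor? (x ∷ y ∷ [])
  xz? : Dec (IsDivisor xyz (x ∷ z ∷ []))
  xz? = divisor? (x ∷ z ∷ [])
  yz? : Dec (IsDivisor xyz (y ∷ z ∷ []))
  yz? = divisor? (y ∷ z ∷ [])

  pairDivisor? : Dec ((IsDivisor xyz (x ∷ y ∷ []) ⊎ IsDivisor xyz (x ∷ z ∷ [])) ⊎ IsDivisor xyz (y ∷ z ∷ []))
  pairDivisor? = (xy? ⊎-dec xz?) ⊎-dec yz?

  -- A dividing pair is at most the remaining element, and no two pairs can both be.
  pairCount≡𝟙 : pairCount ≡ 𝟙 pairDivisor?
  pairCount≡𝟙 = begin
    𝟙[ x ∷ y ∷ [] ] + 𝟙[ x ∷ z ∷ [] ] + 𝟙[ y ∷ z ∷ [] ]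
      ≡⟨ cong (_+ 𝟙[ y ∷ z ∷ [] ]) (𝟙-+-exclusive xy-xz xy? xz?) ⟩
    𝟙 (xy? ⊎-dec xz?) + 𝟙[ y ∷ z ∷ [] ]
      ≡⟨ 𝟙-+-exclusive xy⊎xz-yz (xy? ⊎-dec xz?) yz? ⟩
    𝟙 pairDivisor?
      ∎
    where
    open ≡-Reasoning
    xy≤ : IsDivisor xyz (x ∷ y ∷ []) → x + y ≤ z
    xy≤ = pair-isDivisor⇒≤ xyz y x>0 z>0 S≡xy+z
    xz≤ : IsDivisor xyz (x ∷ z ∷ []) → x + z ≤ y
    xz≤ = pair-isDivisor⇒≤ xyz z x>0 y>0 S≡xz+y
    yz≤ : IsDivisor xyz (y ∷ z ∷ []) → y + z ≤ x
    yz≤ = pair-isDivisor⇒≤ xyz z y>0 x>0 S≡yz+x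
    xy-xz : IsDivisor xyz (x ∷ y ∷ []) → ¬ IsDivisor xyz (x ∷ z ∷ [])
    xy-xz Dxy Dxz = crossed-bounds⇒⊥ x>0 (xy≤ Dxy) (xz≤ Dxz)
    xy⊎xz-yz : IsDivisor xyz (x ∷ y ∷ []) ⊎ IsDivisor xyz (x ∷ z ∷ []) → ¬ IsDivisor xyz (y ∷ z ∷ [])
    xy⊎xz-yz (inj₁ Dxy) Dyz =
      crossed-bounds⇒⊥ y>0 (subst (_≤ z) (+-comm x y) (xy≤ Dxy)) (yz≤ Dyz)
    xy⊎xz-yz (inj₂ Dxz) Dyz = crossed-bounds⇒⊥ z>0
      (subst (_≤ y) (+-comm x z) (xz≤ Dxz)) (subst (_≤ x) (+-comm y z) (yz≤ Dyz))

  singletonCount≤3 : singletonCount ≤ 3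
  singletonCount≤3 =
    +-mono-≤ (+-mono-≤ (𝟙≤1 (divisor? [ x ])) (𝟙≤1 (divisor? [ y ]))) (𝟙≤1 (divisor? [ z ]))

  pairCount≤1 : pairCount ≤ 1
  pairCount≤1 = subst (_≤ 1) (sym pairCount≡𝟙) (𝟙≤1 pairDivisor?)

  d≤5 : d xyz ≤ 5
  d≤5 = subst (_≤ 5) (sym d≡counts) (+-monoˡ-≤ 1 (+-mono-≤ singletonCount≤3 pairCount≤1))

  singletonCount≡3⇔ : singletonCount ≡ 3 ⇔ (x ∣ S × y ∣ S × z ∣ S)
  singletonCount≡3⇔ = ⇔-trans (𝟙+𝟙+𝟙≡3⇔ (divisor? [ x ]) (divisor? [ y ]) (divisor? [ z ]))
    (singleton-isDivisor⇔ xyz x>0 ×-⇔ singleton-isDivisor⇔ xyz y>0 ×-⇔ singleton-isDivisor⇔ xyz z>0)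

  pairCount≡1⇔ : pairCount ≡ 1 ⇔ ((x + y ∣ S ⊎ x + z ∣ S) ⊎ y + z ∣ S)
  pairCount≡1⇔ = subst (λ c → c ≡ 1 ⇔ ((x + y ∣ S ⊎ x + z ∣ S) ⊎ y + z ∣ S)) (sym pairCount≡𝟙)
    (⇔-trans (𝟙≡1⇔ pairDivisor?)
             ((pair-isDivisor⇔ xyz y x>0 ⊎-⇔ pair-isDivisor⇔ xyz z x>0) ⊎-⇔ pair-isDivisor⇔ xyz z y>0))

  d≡5⇔ : d xyz ≡ 5 ⇔ ((x ∣ S × y ∣ S × z ∣ S) × ((x + y ∣ S ⊎ x + z ∣ S) ⊎ y + z ∣ S))
  d≡5⇔ = ⇔-trans counts⇔ (singletonCount≡3⇔ ×-⇔ pairCount≡1⇔)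
    where
    counts⇔ : d xyz ≡ 5 ⇔ (singletonCount ≡ 3 × pairCount ≡ 1)
    counts⇔ = mk⇔
      (λ d≡5 → +-≤-tight singletonCount≤3 pairCount≤1 (+-cancelʳ-≡ 1 _ 4 (trans (sym d≡counts) d≡5)))
      (λ (s≡3 , p≡1) → trans d≡counts (cong₂ (λ s p → s + p + 1) s≡3 p≡1))

  d≡5⇒↭oneTwoThree : x ≢ y → x ≢ z → y ≢ z → d xyz ≡ 5 → ∃ λ a → 0 < a × xyz ↭ oneTwoThree a
  d≡5⇒↭oneTwoThree x≢y x≢z y≢z d≡5 with to d≡5⇔ d≡5
  ... | (x∣ , y∣ , z∣) , inj₁ (inj₁ xy∣) =
    dividing-triple⇒↭oneTwoThree x>0 y>0 x≢y S≡xy+z x∣ y∣ z∣ xy∣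
  ... | (x∣ , y∣ , z∣) , inj₁ (inj₂ xz∣) = map₂ (map₂ (↭-trans xyz↭xzy))
    (dividing-triple⇒↭oneTwoThree x>0 z>0 x≢z S≡xz+y x∣ z∣ y∣ xz∣)
  ... | (x∣ , y∣ , z∣) , inj₂ yz∣ = map₂ (map₂ (↭-trans xyz↭yzx))
    (dividing-triple⇒↭oneTwoThree y>0 z>0 y≢z S≡yz+x y∣ z∣ x∣ yz∣)

  -- The element 3a leaves a pair summing to S - 3a = 3a.
  ↭oneTwoThree⇒d≡5 : xyz ↭ oneTwoThree a → d xyz ≡ 5
  ↭oneTwoThree⇒d≡5 {a} σ =
    from d≡5⇔ ((∣S (here refl) , ∣S (there (here refl)) , ∣S (there (there (here refl)))) , pair)
    where
    S≡6a : S ≡ 3 * a + 3 * a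
    S≡6a = trans (sum-↭ σ) (sum-oneTwoThree a)
    ∣S : w ∈ xyz → w ∣ S
    ∣S {w} w∈ = subst (w ∣_) (sym S≡6a) (∈-oneTwoThree⇒∣ (∈-resp-↭ σ w∈))
    S≡double : 3 * a ≡ w → S ≡ w + w
    S≡double refl = S≡6a
    pair : (x + y ∣ S ⊎ x + z ∣ S) ⊎ y + z ∣ S
    pair with ∈-resp-↭ (↭-sym σ) (there (there (here refl)))
    ... | here 3a≡x                 = inj₂ (complement-∣ y z x S≡yz+x (S≡double 3a≡x))
    ... | there (here 3a≡y)         = inj₁ (inj₂ (complement-∣ x z y S≡xz+y (S≡double 3a≡y)))
    ... | there (there (here 3a≡z)) = inj₁ (inj₁ (complement-∣ x y z S≡xy+z (S≡double 3a≡z)))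

d≡5⇔oneTwoThree : ∀ A → IsPosSet 3 A →
                  (d A ≡ 5 ⇔ ∃ λ a → 0 < a × (∀ x → x ∈ A ⇔ x ∈ oneTwoThree a))
d≡5⇔oneTwoThree (x ∷ y ∷ z ∷ []) (A! , x>0 ∷ y>0 ∷ z>0 ∷ [] , refl) with A!
... | (x≢y ∷ x≢z ∷ []) ∷ (y≢z ∷ []) ∷ [] ∷ [] = mk⇔
  (map₂ (map₂ ↭⇒∈⇔) ∘ d≡5⇒↭oneTwoThree x≢y x≢z y≢z)
  (λ (a , a>0 , ∈⇔) → ↭oneTwoThree⇒d≡5 (∈⇔⇒↭ A! (unique-oneTwoThree a>0) ∈⇔))
  where open Triple x>0 y>0 z>0

mainTheorem11 : DMax 1 1 × DMax 2 2 × DMax 3 5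
    × (∀ (A : List ℕ) → IsPosSet 3 A →
        (d A ≡ 5 ⇔ ∃ λ a → 0 < a × (∀ x → x ∈ A ⇔ x ∈ (a ∷ 2 * a ∷ 3 * a ∷ []))))
mainTheorem11 =
  ((1 ∷ [] , ([] ∷ [] , z<s ∷ [] , refl) , refl) ,
   λ { (x ∷ []) _ → d-singleton≤1 x }) ,
  ((1 ∷ 2 ∷ [] , (((λ ()) ∷ []) ∷ [] ∷ [] , z<s ∷ z<s ∷ [] , refl) , refl) ,
   λ { (x ∷ y ∷ []) ((x≢y ∷ []) ∷ _ , x>0 ∷ y>0 ∷ [] , refl) → d-pair≤2 x>0 y>0 x≢y }) ,
  ((oneTwoThree 1 , (unique-oneTwoThree z<s , z<s ∷ z<s ∷ z<s ∷ [] , refl) , refl) ,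
   λ { (x ∷ y ∷ z ∷ []) (_ , x>0 ∷ y>0 ∷ z>0 ∷ [] , refl) → Triple.d≤5 x>0 y>0 z>0 }) ,
  d≡5⇔oneTwoThree
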